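{- Let $n>1$ and suppose that the $n$-th left diagonal $L_n$ of the Calkin–Wilf tree is given by $L_n=\left(\frac{aj+b}{cj+d}\right)_{j\ge 1}$, i.e. its $j$-th term is $\frac{aj+b}{cj+d}$ for every $j\ge1$. Then $L_{2n-1}=\left(\frac{aj+b}{(a+c)j+(b+d)}\right)_{j\ge1}$ and $L_{2n}=\left(\frac{(a+c)j+(b+d)}{cj+d}\right)_{j\ge1}$.
   Context: The Calkin–Wilf tree is the rooted infinite binary tree whose vertices are labeled by fractions: the root is $\frac{1}{1}$, and a vertex labeled $\frac{a}{b}$ has left child $\frac{a}{a+b}$ and right child $\frac{a+b}{b}$. The root is at level $1$; level $k$ has $2^{k-1}$ vertices, ordered from left to right so that the children of the $i$-th vertex of level $k$ are the $(2i-1)$-th (left child) and $(2i)$-th (right child) vertices of level $k+1$. For $m\ge1$, let $k_m$ be the least $k\ge1$ with $2^{k-1}\ge m$. The $m$-th left diagonal $L_m$ is the sequence whose $j$-th term ($j\ge1$) is the $m$-th vertex (counted from the left) of level $k_m+j-1$. For example $L_1=(\frac{1}{j})$, $L_2=(\frac{j+1}{j})$, $L_3=(\frac{j+1}{2j+1})$, $L_4=(\frac{2j+1}{j})$. -}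

module Defs where

open import Data.Bool using (Bool; true; false; if_then_else_)
open import Data.Nat using (ℕ; zero; suc; _+_; _*_; _∸_; _^_; _≤ᵇ_; _/_; _%_; _≡ᵇ_)
open import Data.Product using (_×_; _,_)
open import Data.Integer as ℤ using (ℤ; +_)
open import Relation.Binary.PropositionalEquality using (_≡_; _≢_)

-- A vertex label a/b of the Calkin–Wilf tree, stored as the pair (a , b)
-- (numerator , denominator), with a, b positive naturals.
Label : Set
Label = ℕ × ℕ

leftChild : Label → Label
leftChild (a , b) = (a , a + b)

rightChild : Label → Label
rightChild (a , b) = (a + b , b)

-- cw₀ k i : the vertex at 0-based level k (paper level k+1) and 0-based
-- position i (paper position i+1) from the left, 0 ≤ i < 2^k.
-- The parent of 0-based position i is i / 2; it is a left child iff i is even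
-- (paper: children of the i-th vertex are the (2i-1)-th and (2i)-th).
cw₀ : ℕ → ℕ → Label
cw₀ zero    i = (1 , 1)
cw₀ (suc k) i = if (i % 2) ≡ᵇ 0 then leftChild (cw₀ k (i / 2))
                                 else rightChild (cw₀ k (i / 2))

vertex : ℕ → ℕ → Label
vertex k m = cw₀ (k ∸ 1) (m ∸ 1)

-- k_m : least k ≥ 1 with 2^(k-1) ≥ m, found by bounded search starting at k = 1.
-- (Fuel m suffices for m ≥ 1 since 2^(m-1) ≥ m.)
searchK : ℕ → ℕ → ℕ → ℕ
searchK zero    m k = k
searchK (suc f) m k = if m ≤ᵇ 2 ^ (k ∸ 1) then k else searchK f m (suc k)

kOf : ℕ → ℕ
kOf m = searchK m m 1

L : ℕ → ℕ → Label
L m j = vertex (kOf m + j ∸ 1) m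

_≐_/_ : Label → ℤ → ℤ → Set
(x , y) ≐ p / q = (q ≢ + 0) × ((+ x) ℤ.* q ≡ (+ y) ℤ.* p)

infix 4 _≐_/_

module Submission where

-- The n-th left diagonal of the Calkin–Wilf tree runs down the tree through
-- position n of the consecutive levels k_n, k_n + 1, …  For n > 1 the
-- positions 2n-1 and 2n on the next level are exactly the two children of
-- position n, and k_{2n-1} = k_{2n} = k_n + 1.  Hence the j-th term of
-- L_{2n-1} (resp. L_{2n}) is the left (resp. right) child of the j-th term of
-- L_n.  Since the children of x/y are x/(x+y) and (x+y)/y, a term x/y = P/Q of
-- L_n yields the terms P/(P+Q) and (P+Q)/Q, and with P = aj+b, Q = cj+d this
-- is the claimed formula.

open import Defs
open import Data.Nat using (ℕ; _≤_; _<_; _∸_)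
open import Data.Integer using (ℤ; +_; _+_; _*_)
open import Data.Product using (_×_; ∃-syntax; _,_; proj₁; proj₂)

import Data.Nat as Nat
open Nat using (zero; suc; z≤n; s≤s; _^_; _≤ᵇ_)
open import Data.Nat.Properties
  using ( ≤-refl; ≤-reflexive; ≤-trans; ≤-antisym; ≤-pred; ≤-<-trans; <⇒≤; <⇒≱; ≮⇒≥; ≤∧≢⇒<
        ; n<1+n; m≤n⇒m≤1+n; m≤n+m; m∸n≤m; +-identityʳ; +-suc; *-suc; *-comm
        ; *-monoʳ-≤; ∸-monoˡ-≤; ^-monoʳ-≤; ^-monoʳ-<; m+n≡0⇒n≡0
        ; ≤ᵇ-reflects-≤; _≟_; module ≤-Reasoning )
open import Data.Nat.DivMod using (m*n%n≡0; m*n/n≡m; [m+kn]%n≡m%n; +-distrib-/-∣ʳ)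
open import Data.Nat.Divisibility using (n∣m*n)
import Data.Integer.Properties as ℤP
open import Data.Integer.Tactic.RingSolver using (solve-∀)
open import Data.Bool using (true; false)
open import Data.Sum using (inj₁; inj₂)
open import Relation.Nullary using (yes; no; ofʸ; ofⁿ)
open import Relation.Binary.PropositionalEquality
  using (_≡_; _≢_; refl; sym; trans; cong; subst; subst₂; module ≡-Reasoning)

-- u is the least exponent with m ≤ 2^u; then k_m = u + 1.
LeastExp : ℕ → ℕ → Set
LeastExp m u = m ≤ 2 ^ u × (∀ {v} → v < u → 2 ^ v < m)

n<2^n : ∀ n → n < 2 ^ n
n<2^n zero    = s≤s z≤n
n<2^n (suc n) = ≤-<-trans (n<2^n n) (^-monoʳ-< 2 (s≤s (s≤s z≤n)) (n<1+n n))

-- Every m has a least exponent: pass from m to m + 1, moving up one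
-- exponent exactly when m is a power of two.
leastExp-exists : ∀ m → ∃[ u ] LeastExp m u
leastExp-exists zero = 0 , z≤n , λ ()
leastExp-exists (suc m) with leastExp-exists m
... | u , m≤2^u , below with m ≟ 2 ^ u
...   | no  m≢2^u = u , ≤∧≢⇒< m≤2^u m≢2^u , λ v<u → m≤n⇒m≤1+n (below v<u)
...   | yes m≡2^u = suc u , upper , below′
  where
  upper : suc m ≤ 2 ^ suc u
  upper = subst (λ k → suc k ≤ 2 ^ suc u) (sym m≡2^u) (^-monoʳ-< 2 (s≤s (s≤s z≤n)) (n<1+n u))
  below′ : ∀ {v} → v < suc u → 2 ^ v < suc m
  below′ {v} v<1+u = s≤s (subst (2 ^ v ≤_) (sym m≡2^u) (^-monoʳ-≤ 2 (≤-pred v<1+u)))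

leastExp-bound : ∀ {m u} → LeastExp m u → u ≤ m
leastExp-bound {m} (_ , below) = ≮⇒≥ λ m<u → <⇒≱ (below m<u) (<⇒≤ (n<2^n m))

searchK-least : ∀ f {m u w} → LeastExp m w → u ≤ w → w ≤ u Nat.+ f →
                searchK f m (suc u) ≡ suc w
searchK-least zero {u = u} _ u≤w w≤u+0 =
  cong suc (≤-antisym u≤w (subst (_ ≤_) (+-identityʳ u) w≤u+0))
searchK-least (suc f) {m} {u} {w} (m≤2^w , below) u≤w w≤u+1+f
  with m ≤ᵇ 2 ^ u | ≤ᵇ-reflects-≤ m (2 ^ u)
... | true  | ofʸ m≤2^u = cong suc (≤-antisym u≤w (≮⇒≥ λ u<w → <⇒≱ (below u<w) m≤2^u))
... | false | ofⁿ m≰2^u =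
  searchK-least f (m≤2^w , below) u<w (subst (w ≤_) (+-suc u f) w≤u+1+f)
  where
  u<w : u < w
  u<w = ≤∧≢⇒< u≤w λ u≡w → m≰2^u (subst (λ k → m ≤ 2 ^ k) (sym u≡w) m≤2^w)

kOf-leastExp : ∀ {m u} → LeastExp m u → kOf m ≡ suc u
kOf-leastExp le = searchK-least _ le z≤n (leastExp-bound le)

-- 2k < 2n - 1 whenever k < n: the gap used to compare 2^(v+1) with 2n - 1.
double-gap : ∀ {k n} → k < n → 2 Nat.* k < 2 Nat.* n ∸ 1
double-gap {k} {n} k<n = begin-strict
  2 Nat.* k             <⟨ n<1+n _ ⟩
  suc (2 Nat.* k)       ≡⟨ cong (_∸ 1) (sym (*-suc 2 k)) ⟩
  2 Nat.* suc k ∸ 1     ≤⟨ ∸-monoˡ-≤ 1 (*-monoʳ-≤ 2 k<n) ⟩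
  2 Nat.* n ∸ 1         ∎
  where open ≤-Reasoning

-- If n > 1 has least exponent u, every m with 2n - 1 ≤ m ≤ 2n has least
-- exponent u + 1 (for n = 1 this fails at m = 1).
leastExp-double : ∀ {n u m} → 1 < n → LeastExp n u →
                  2 Nat.* n ∸ 1 ≤ m → m ≤ 2 Nat.* n → LeastExp m (suc u)
leastExp-double {n} {u} {m} 1<n (n≤2^u , below) lo hi =
  ≤-trans hi (*-monoʳ-≤ 2 n≤2^u) , below′
  where
  below′ : ∀ {v} → v < suc u → 2 ^ v < m
  below′ {zero}  _         = ≤-trans (s≤s (s≤s z≤n)) (≤-trans (double-gap 1<n) lo)
  below′ {suc v} (s≤s v<u) = ≤-trans (double-gap (below v<u)) lo

cw₀-even : ∀ k p → cw₀ (suc k) (p Nat.* 2) ≡ leftChild (cw₀ k p)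
cw₀-even k p rewrite m*n%n≡0 p 2 ⦃ _ ⦄ | m*n/n≡m p 2 ⦃ _ ⦄ = refl

cw₀-odd : ∀ k p → cw₀ (suc k) (1 Nat.+ p Nat.* 2) ≡ rightChild (cw₀ k p)
cw₀-odd k p rewrite [m+kn]%n≡m%n 1 p 2 ⦃ _ ⦄ =
  cong (λ i → rightChild (cw₀ k i)) (trans (+-distrib-/-∣ʳ 1 {d = 2} (n∣m*n p)) (m*n/n≡m p 2 ⦃ _ ⦄))

cw₀-denominator-pos : ∀ k i → 0 < proj₂ (cw₀ k i)
cw₀-denominator-pos zero    i = s≤s z≤n
cw₀-denominator-pos (suc k) i with (i Nat.% 2) Nat.≡ᵇ 0
... | true  = ≤-trans (cw₀-denominator-pos k (i Nat./ 2)) (m≤n+m _ _)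
... | false = cw₀-denominator-pos k (i Nat./ 2)

L-denominator-pos : ∀ m j → 0 < proj₂ (L m j)
L-denominator-pos m j = cw₀-denominator-pos (kOf m Nat.+ j ∸ 1 ∸ 1) (m ∸ 1)

L-term : ∀ m {u} → kOf m ≡ suc u → ∀ j → L m (suc j) ≡ cw₀ (u Nat.+ j) (m ∸ 1)
L-term m {u} k≡ j rewrite k≡ | +-suc u j = refl

odd-position : ∀ p → 2 Nat.* suc p ∸ 1 ≡ 1 Nat.+ p Nat.* 2
odd-position p = cong (_∸ 1) (trans (*-suc 2 p) (cong (2 Nat.+_) (*-comm 2 p)))

L-children : ∀ {n} → 1 < n → ∀ j →
  L (2 Nat.* n ∸ 1) (suc j) ≡ leftChild (L n (suc j)) ×
  L (2 Nat.* n) (suc j) ≡ rightChild (L n (suc j))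
L-children {n@(suc p)} 1<n j with leastExp-exists n
... | u , le = left , right
  where
  open ≡-Reasoning
  Lₙ : L n (suc j) ≡ cw₀ (u Nat.+ j) p
  Lₙ = L-term n (kOf-leastExp le) j
  left : L (2 Nat.* n ∸ 1) (suc j) ≡ leftChild (L n (suc j))
  left = begin
    L (2 Nat.* n ∸ 1) (suc j)
      ≡⟨ L-term (2 Nat.* n ∸ 1) (kOf-leastExp (leastExp-double 1<n le ≤-refl (m∸n≤m _ 1))) j ⟩
    cw₀ (suc (u Nat.+ j)) (2 Nat.* n ∸ 1 ∸ 1)
      ≡⟨ cong (λ i → cw₀ (suc (u Nat.+ j)) (i ∸ 1)) (odd-position p) ⟩
    cw₀ (suc (u Nat.+ j)) (p Nat.* 2)
      ≡⟨ cw₀-even (u Nat.+ j) p ⟩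
    leftChild (cw₀ (u Nat.+ j) p)
      ≡⟨ cong leftChild (sym Lₙ) ⟩
    leftChild (L n (suc j)) ∎
  right : L (2 Nat.* n) (suc j) ≡ rightChild (L n (suc j))
  right = begin
    L (2 Nat.* n) (suc j)
      ≡⟨ L-term (2 Nat.* n) (kOf-leastExp (leastExp-double 1<n le (m∸n≤m _ 1) ≤-refl)) j ⟩
    cw₀ (suc (u Nat.+ j)) (2 Nat.* n ∸ 1)
      ≡⟨ cong (cw₀ (suc (u Nat.+ j))) (odd-position p) ⟩
    cw₀ (suc (u Nat.+ j)) (1 Nat.+ p Nat.* 2)
      ≡⟨ cw₀-odd (u Nat.+ j) p ⟩
    rightChild (cw₀ (u Nat.+ j) p)
      ≡⟨ cong rightChild (sym Lₙ) ⟩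
    rightChild (L n (suc j)) ∎

mediant-cross : ∀ x y P Q → + x * Q ≡ + y * P → + (x Nat.+ y) * Q ≡ + y * (P + Q)
mediant-cross x y P Q xQ≡yP = begin
  + (x Nat.+ y) * Q      ≡⟨ cong (_* Q) (ℤP.pos-+ x y) ⟩
  (+ x + + y) * Q        ≡⟨ ℤP.*-distribʳ-+ Q (+ x) (+ y) ⟩
  + x * Q + + y * Q      ≡⟨ cong (_+ + y * Q) xQ≡yP ⟩
  + y * P + + y * Q      ≡⟨ sym (ℤP.*-distribˡ-+ (+ y) P Q) ⟩
  + y * (P + Q)          ∎
  where open ≡-Reasoning

≐-rightChild : ∀ {t P Q} → t ≐ P / Q → rightChild t ≐ P + Q / Q
≐-rightChild {x , y} {P} {Q} (Q≢0 , xQ≡yP) = Q≢0 , mediant-cross x y P Q xQ≡yP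

-- If x/y = P/Q with y > 0 then its left child x/(x+y) equals P/(P+Q); the
-- positivity of y is what rules out P + Q = 0.
≐-leftChild : ∀ {t P Q} → t ≐ P / Q → 0 < proj₂ t → leftChild t ≐ P / P + Q
≐-leftChild {x , y} {P} {Q} (Q≢0 , xQ≡yP) 0<y = P+Q≢0 , cross
  where
  open ≡-Reasoning
  cross : + x * (P + Q) ≡ + (x Nat.+ y) * P
  cross = begin
    + x * (P + Q)        ≡⟨ ℤP.*-distribˡ-+ (+ x) P Q ⟩
    + x * P + + x * Q    ≡⟨ cong (_+_ (+ x * P)) xQ≡yP ⟩
    + x * P + + y * P    ≡⟨ sym (ℤP.*-distribʳ-+ P (+ x) (+ y)) ⟩
    (+ x + + y) * P      ≡⟨ cong (_* P) (sym (ℤP.pos-+ x y)) ⟩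
    + (x Nat.+ y) * P    ∎
  P+Q≢0 : P + Q ≢ + 0
  P+Q≢0 P+Q≡0 with ℤP.i*j≡0⇒i≡0∨j≡0 (+ (x Nat.+ y)) [x+y]Q≡0
    where
    [x+y]Q≡0 : + (x Nat.+ y) * Q ≡ + 0
    [x+y]Q≡0 = trans (mediant-cross x y P Q xQ≡yP)
                     (trans (cong (+ y *_) P+Q≡0) (ℤP.*-zeroʳ (+ y)))
  ... | inj₁ x+y≡0 = <⇒≱ 0<y (≤-reflexive (m+n≡0⇒n≡0 x (ℤP.+-injective x+y≡0)))
  ... | inj₂ Q≡0   = Q≢0 Q≡0

affine-sum : ∀ a b c d J → (a + c) * J + (b + d) ≡ (a * J + b) + (c * J + d)
affine-sum = solve-∀

mainTheorem2 : (n : ℕ) → 1 < n → (a b c d : ℤ) →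
  (∀ (j : ℕ) → 1 ≤ j → L n j ≐ a * + j + b / c * + j + d) →
  (∀ (j : ℕ) → 1 ≤ j →
    L (2 Data.Nat.* n ∸ 1) j ≐ a * + j + b / (a + c) * + j + (b + d))
  × (∀ (j : ℕ) → 1 ≤ j →
    L (2 Data.Nat.* n) j ≐ (a + c) * + j + (b + d) / c * + j + d)
mainTheorem2 n 1<n a b c d Lₙ≐ = left , right
  where
  left : ∀ j → 1 ≤ j → L (2 Nat.* n ∸ 1) j ≐ a * + j + b / (a + c) * + j + (b + d)
  left (suc j) _ =
    subst₂ (λ t R → t ≐ a * + suc j + b / R)
      (sym (proj₁ (L-children 1<n j))) (sym (affine-sum a b c d (+ suc j)))
      (≐-leftChild {L n (suc j)} (Lₙ≐ (suc j) (s≤s z≤n)) (L-denominator-pos n (suc j)))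
  right : ∀ j → 1 ≤ j → L (2 Nat.* n) j ≐ (a + c) * + j + (b + d) / c * + j + d
  right (suc j) _ =
    subst₂ (λ t P → t ≐ P / c * + suc j + d)
      (sym (proj₂ (L-children 1<n j))) (sym (affine-sum a b c d (+ suc j)))
      (≐-rightChild {L n (suc j)} (Lₙ≐ (suc j) (s≤s z≤n)))
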